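{- For all $n\ge1$, \[C_n=\frac{1}{n+1}\binom{2n}{n}=\sum_{d\mid n}\ \sum_{\substack{[\mu]\in\mathsf{CComp}_{n/d}\\ [\mu]\text{ primitive}}}\frac{1}{d}\binom{n}{\mathsf{ord}[\mu]\cdot d-1}.\]
   Context: A composition of $n$ is a sequence of positive integers summing to $n$. A cyclic composition $[\mu]$ is the equivalence class of a composition $\mu$ under cyclic shift; $\mathsf{CComp}_{n}$ is the set of all cyclic compositions of $n$ (with any number of parts). $\mathsf{ord}[\mu]$ is the number of distinct compositions in the class $[\mu]$, and $[\mu]$ is primitive if $\mathsf{ord}[\mu]$ equals the number of parts of $\mu$. -}

module Defs where

open import Data.Nat using (ℕ; zero; suc; _+_; _*_; _∸_; _≟_)
open import Data.Nat.Divisibility using (_∣?_)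
open import Data.Nat.DivMod using (_/_)
open import Data.Nat.Combinatorics using (_C_)
open import Data.Bool using (Bool; true; false; _∧_; if_then_else_)
open import Data.List using (List; []; _∷_; _++_; [_]; length; map; foldr; concatMap; filterᵇ; deduplicate; upTo; filter)
open import Data.List.Properties using (≡-dec)
open import Data.Integer using (+_)
open import Data.List.Relation.Unary.All using () 
open import Data.Bool.ListAction using (all)
open import Data.Rational as ℚ using (ℚ; 0ℚ)
open import Relation.Nullary.Decidable using (⌊_⌋)

-- Compositions of m (lists of positive integers summing to m).
-- A composition of m+1 arises uniquely from one of m by either
-- prepending a part 1, or increasing the first part by 1.
compositions : ℕ → List (List ℕ)
compositions zero = [] ∷ []
compositions (suc m) = concatMap step (compositions m)
  where
  step : List ℕ → List (List ℕ)
  step [] = (1 ∷ []) ∷ []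
  step (k ∷ rest) = (1 ∷ k ∷ rest) ∷ (suc k ∷ rest) ∷ []

rotate : List ℕ → List ℕ
rotate [] = []
rotate (x ∷ xs) = xs ++ [ x ]

rotateN : ℕ → List ℕ → List ℕ
rotateN zero μ = μ
rotateN (suc k) μ = rotateN k (rotate μ)

-- all cyclic shifts of μ (with repetitions), i.e. the class [μ]
rotations : List ℕ → List (List ℕ)
rotations μ = map (λ k → rotateN k μ) (upTo (length μ))

ord : List ℕ → ℕ
ord μ = length (deduplicate (≡-dec _≟_) (rotations μ))

primitive? : List ℕ → Bool
primitive? μ = ⌊ ord μ ≟ length μ ⌋

lexLeq : List ℕ → List ℕ → Bool
lexLeq [] _ = true
lexLeq (_ ∷ _) [] = false
lexLeq (x ∷ xs) (y ∷ ys) with ⌊ x ≟ y ⌋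
... | true = lexLeq xs ys
... | false = Data.Nat._<ᵇ_ x y

-- μ is the chosen representative of its class [μ]: lexicographically
-- least among its cyclic shifts (exactly one composition per class).
isRep : List ℕ → Bool
isRep μ = all (lexLeq μ) (rotations μ)

-- CComp m, each cyclic composition represented by its canonical member
CComp : ℕ → List (List ℕ)
CComp m = filterᵇ isRep (compositions m)

sumℚ : List ℚ → ℚ
sumℚ = foldr ℚ._+_ 0ℚ

catalan : ℕ → ℚ
catalan n = (+ ((2 * n) C n)) ℚ./ suc n

-- RHS: sum over divisors d = suc i of n (1 ≤ d ≤ n), over primitive
-- [μ] ∈ CComp (n/d), of (1/d) binom(n, ord[μ]·d − 1)
rhs : ℕ → ℚ
rhs n = sumℚ (map term (filter (λ i → suc i ∣? n) (upTo n)))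
  where
  term : ℕ → ℚ
  term i = sumℚ (map (λ μ → (+ (n C (ord μ * suc i ∸ 1))) ℚ./ suc i)
                     (filterᵇ primitive? (CComp (n / suc i))))

-- Every word w factors uniquely as v^(d+1) with v primitive: the least period of w divides |w|,
-- and a primitive root is determined by its length. Each primitive v is a rotation of exactly one
-- lexicographically least representative μ, so the compositions of n correspond bijectively to
-- triples (d+1 ∣ n, primitive [μ] ∈ CComp (n/(d+1)), r < ord[μ]) via w = (rotateN r μ)^(d+1), and
-- this w has (d+1)·ord[μ] parts. Summing (1/k)·C(n, k−1) over the compositions with k parts gives
-- ∑ₖ C(n−1, k−1)·C(n, k−1)/k = C_n (absorption and Vandermonde); summing it along the bijection
-- gives ord[μ] · C(n, (d+1)·ord[μ] − 1)/((d+1)·ord[μ]) = C(n, ord[μ]·(d+1) − 1)/(d+1) per class.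

module Submission where

open import Defs
open import Data.Nat
open import Data.Nat.Properties
open import Data.Nat.DivMod using (_%_; _/_; m≡m%n+[m/n]*n; m%n<n; m/n*n≡m; m*n/n≡m; m≥n⇒m/n>0)
open import Data.Nat.Divisibility using (_∣_; _∣?_; divides; m%n≡0⇒n∣m)
open import Data.Nat.Combinatorics using (_C_; nCk+nC[k+1]≡[n+1]C[k+1]; nC1≡n; k>n⇒nCk≡0)
open import Data.Nat.ListAction using (sum)
open import Data.Nat.ListAction.Properties using (sum-++)
open import Data.Nat.Tactic.RingSolver using (solve-∀)
open import Data.Integer as ℤ using (+_)
import Data.Integer.Properties as ℤ
open import Data.Rational as ℚ using (ℚ; 0ℚ)
import Data.Rational.Properties as ℚ
open import Data.Rational.Unnormalised as ℚᵘ using (mkℚᵘ; *≡*)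
import Data.Rational.Unnormalised.Properties as ℚᵘ
open import Algebra.Bundles using (CommutativeMonoid)
open import Algebra.Properties.CommutativeSemigroup (CommutativeMonoid.commutativeSemigroup ℚ.+-0-commutativeMonoid)
  using (interchange)
open import Data.Bool using (T)
open import Data.List
  using (List; []; _∷_; _++_; [_]; length; map; concatMap; take; drop; filter; filterᵇ; deduplicate; applyUpTo; upTo)
open import Data.List.Properties
  using (++-assoc; ++-identityʳ; length-++; length-take; length-drop; take++drop≡id; ∷-injective; ∷-injectiveʳ; ≡-dec;
         filter-all; filter-notAll; length-deduplicate; map-applyUpTo; length-applyUpTo; length-map; length-upTo;
         map-++; map-∘; map-cong-local; concatMap-cong)
open import Data.List.Membership.Propositional using (_∈_; find; lose)
open import Data.List.Membership.Propositional.Properties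
  using (∈-deduplicate⁺; ∈-applyUpTo⁺; ∈-map⁺; ∈-map⁻; ∈-upTo⁺; ∈-upTo⁻; ∈-filter⁺; ∈-filter⁻; ∈-concatMap⁺; ∈-concatMap⁻)
open import Data.List.Membership.Propositional.Properties.WithK using (unique∧set⇒bag)
open import Data.List.Relation.Binary.BagAndSetEquality using (∼bag⇒↭)
open import Data.List.Relation.Binary.Permutation.Propositional using (↭⇒↭ₛ)
import Data.List.Relation.Binary.Permutation.Propositional.Properties as ↭
open import Data.List.Relation.Binary.Permutation.Setoid.Properties using (foldr-commMonoid)
open import Data.List.Relation.Unary.All as All using (All; []; _∷_)
open import Data.List.Relation.Unary.All.Properties as Allₚ using (all⁺; all⁻)
import Data.List.Relation.Unary.Any as Any
open import Data.List.Relation.Unary.Any using (here; there)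
open import Data.List.Relation.Unary.Unique.Propositional using (Unique; []; _∷_)
open import Data.List.Relation.Unary.Unique.Propositional.Properties using (++⁺; applyUpTo⁺₁; filter⁺; upTo⁺)
open import Data.Product using (∃; ∃₂; _×_; _,_; proj₁; proj₂)
open import Data.Sum using (_⊎_; inj₁; inj₂; [_,_]′)
open import Function using (_∘_; id; mk⇔)
open import Relation.Nullary using (¬_; ¬?; yes; no; contradiction)
open import Relation.Nullary.Decidable using (T?; fromWitness; toWitness)
open import Relation.Unary using (Decidable)
open import Relation.Binary.Definitions using (DecidableEquality; tri<; tri≈; tri>)
open import Relation.Binary.PropositionalEquality hiding ([_])
open ≡-Reasoning

-- Powers, rotations and primitive roots of words

power : ℕ → List ℕ → List ℕ
power zero    u = []
power (suc d) u = u ++ power d u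

++-injective : ∀ (a b : List ℕ) {x y} → length a ≡ length b → a ++ x ≡ b ++ y → a ≡ b × x ≡ y
++-injective []      []      _ e = refl , e
++-injective (p ∷ a) (q ∷ b) l e =
  let p≡q , e′ = ∷-injective e
      a≡b , x≡y = ++-injective a b (suc-injective l) e′
  in cong₂ _∷_ p≡q a≡b , x≡y

length-rotate : ∀ u → length (rotate u) ≡ length u
length-rotate []       = refl
length-rotate (x ∷ xs) = trans (length-++ xs) (+-comm (length xs) 1)

length-rotateN : ∀ k u → length (rotateN k u) ≡ length u
length-rotateN zero    u = refl
length-rotateN (suc k) u = trans (length-rotateN k (rotate u)) (length-rotate u)

length-power : ∀ d u → length (power d u) ≡ d * length u
length-power zero    u = refl
length-power (suc d) u = trans (length-++ u) (cong (_+_ (length u)) (length-power d u))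

rotateN-+ : ∀ a b u → rotateN (a + b) u ≡ rotateN b (rotateN a u)
rotateN-+ zero    b u = refl
rotateN-+ (suc a) b u = rotateN-+ a b (rotate u)

rotateN-comm : ∀ a b u → rotateN a (rotateN b u) ≡ rotateN b (rotateN a u)
rotateN-comm a b u = begin
  rotateN a (rotateN b u) ≡⟨ rotateN-+ b a u ⟨
  rotateN (b + a) u       ≡⟨ cong (λ k → rotateN k u) (+-comm b a) ⟩
  rotateN (a + b) u       ≡⟨ rotateN-+ a b u ⟩
  rotateN b (rotateN a u) ∎

rotateN-++ : ∀ (xs ys : List ℕ) → rotateN (length xs) (xs ++ ys) ≡ ys ++ xs
rotateN-++ []       ys = sym (++-identityʳ ys)
rotateN-++ (x ∷ xs) ys = begin
  rotateN (length xs) ((xs ++ ys) ++ [ x ]) ≡⟨ cong (rotateN (length xs)) (++-assoc xs ys [ x ]) ⟩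
  rotateN (length xs) (xs ++ ys ++ [ x ])   ≡⟨ rotateN-++ xs (ys ++ [ x ]) ⟩
  (ys ++ [ x ]) ++ xs                       ≡⟨ ++-assoc ys [ x ] xs ⟩
  ys ++ x ∷ xs                              ∎

rotateN-length : ∀ u → rotateN (length u) u ≡ u
rotateN-length u = trans (cong (rotateN (length u)) (sym (++-identityʳ u))) (rotateN-++ u [])

rotateN-*-period : ∀ q {p u} → rotateN p u ≡ u → rotateN (q * p) u ≡ u
rotateN-*-period zero    _ = refl
rotateN-*-period (suc q) {p} {u} e = begin
  rotateN (p + q * p) u         ≡⟨ rotateN-+ p (q * p) u ⟩
  rotateN (q * p) (rotateN p u) ≡⟨ cong (rotateN (q * p)) e ⟩
  rotateN (q * p) u             ≡⟨ rotateN-*-period q e ⟩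
  u                             ∎

rotateN-%-period : ∀ k {p u} .{{_ : NonZero p}} → rotateN p u ≡ u → rotateN (k % p) u ≡ rotateN k u
rotateN-%-period k {p} {u} e = begin
  rotateN (k % p) u                           ≡⟨ cong (rotateN (k % p)) (rotateN-*-period (k / p) e) ⟨
  rotateN (k % p) (rotateN ((k / p) * p) u)   ≡⟨ rotateN-+ ((k / p) * p) (k % p) u ⟨
  rotateN ((k / p) * p + k % p) u             ≡⟨ cong (λ j → rotateN j u) (+-comm ((k / p) * p) (k % p)) ⟩
  rotateN (k % p + (k / p) * p) u             ≡⟨ cong (λ j → rotateN j u) (m≡m%n+[m/n]*n k p) ⟨
  rotateN k u                                 ∎

rotateN-% : ∀ k u .{{_ : NonZero (length u)}} → rotateN (k % length u) u ≡ rotateN k u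
rotateN-% k u = rotateN-%-period k (rotateN-length u)

rotateN-∸-inverse : ∀ {j} u → j ≤ length u → rotateN (length u ∸ j) (rotateN j u) ≡ u
rotateN-∸-inverse {j} u j≤ = begin
  rotateN (length u ∸ j) (rotateN j u) ≡⟨ rotateN-+ j (length u ∸ j) u ⟨
  rotateN (j + (length u ∸ j)) u       ≡⟨ cong (λ k → rotateN k u) (m+[n∸m]≡n j≤) ⟩
  rotateN (length u) u                 ≡⟨ rotateN-length u ⟩
  u                                    ∎

power-[] : ∀ d → power d [] ≡ []
power-[] zero    = refl
power-[] (suc d) = power-[] d

power-∷ʳ : ∀ d x xs → power d (x ∷ xs) ++ [ x ] ≡ x ∷ power d (xs ++ [ x ])
power-∷ʳ zero    x xs = refl
power-∷ʳ (suc d) x xs = cong (x ∷_) (begin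
  (xs ++ power d (x ∷ xs)) ++ [ x ]   ≡⟨ ++-assoc xs _ _ ⟩
  xs ++ power d (x ∷ xs) ++ [ x ]     ≡⟨ cong (xs ++_) (power-∷ʳ d x xs) ⟩
  xs ++ x ∷ power d (xs ++ [ x ])     ≡⟨ ++-assoc xs [ x ] _ ⟨
  (xs ++ [ x ]) ++ power d (xs ++ [ x ]) ∎)

rotate-power : ∀ d u → rotate (power d u) ≡ power d (rotate u)
rotate-power zero    u        = refl
rotate-power (suc d) []       = trans (cong rotate (power-[] d)) (sym (power-[] d))
rotate-power (suc d) (x ∷ xs) = ∷-injectiveʳ (power-∷ʳ (suc d) x xs)

rotateN-power : ∀ k d u → rotateN k (power d u) ≡ power d (rotateN k u)
rotateN-power zero    d u = refl
rotateN-power (suc k) d u = trans (cong (rotateN k) (rotate-power d u)) (rotateN-power k d (rotate u))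

power-injective : ∀ d {a b} → length a ≡ length b → power (suc d) a ≡ power (suc d) b → a ≡ b
power-injective d {a} {b} l e = proj₁ (++-injective a b l e)

++-comm⇒power : ∀ k (u v : List ℕ) → length v ≡ k * length u → v ++ u ≡ u ++ v → v ≡ power k u
++-comm⇒power zero    u [] _ _ = refl
++-comm⇒power (suc k) u v l e = begin
  v                                       ≡⟨ take++drop≡id (length u) v ⟨
  take (length u) v ++ drop (length u) v  ≡⟨ cong₂ _++_ a≡u b≡ ⟩
  u ++ power k u                          ∎
  where
  a b : List ℕ
  a = take (length u) v
  b = drop (length u) v
  length-a : length a ≡ length u
  length-a = trans (length-take (length u) v)
                   (m≤n⇒m⊓n≡m (subst (length u ≤_) (sym l) (m≤m+n (length u) (k * length u))))
  length-b : length b ≡ k * length u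
  length-b = trans (length-drop (length u) v) (trans (cong (_∸ length u) l) (m+n∸m≡n (length u) _))
  split : a ++ (b ++ u) ≡ u ++ (a ++ b)
  split = trans (sym (++-assoc a b u))
            (trans (cong (_++ u) (take++drop≡id (length u) v))
              (trans e (cong (u ++_) (sym (take++drop≡id (length u) v)))))
  a≡u : a ≡ u
  a≡u = proj₁ (++-injective a u length-a split)
  b≡ : b ≡ power k u
  b≡ = ++-comm⇒power k u b length-b (trans (proj₂ (++-injective a u length-a split)) (cong (_++ b) a≡u))

least-below : ∀ {P : ℕ → Set} → Decidable P → ∀ m →
              (∀ {r} → r < m → ¬ P r) ⊎ ∃ λ p → P p × (∀ {r} → r < p → ¬ P r)
least-below P? zero = inj₁ λ ()
least-below P? (suc m) with least-below P? m
... | inj₂ found = inj₂ found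
... | inj₁ none with P? m
...   | yes Pm = inj₂ (m , Pm , none)
...   | no ¬Pm = inj₁ λ r<1+m → [ none , (λ { refl → ¬Pm }) ]′ (m≤n⇒m<n∨m≡n (s≤s⁻¹ r<1+m))

least : ∀ {P : ℕ → Set} → Decidable P → ∀ {m} → P m → ∃ λ p → P p × (∀ {r} → r < p → ¬ P r)
least P? {m} Pm with least-below P? m
... | inj₁ none  = m , Pm , none
... | inj₂ found = found

Primitive : List ℕ → Set
Primitive u = ∀ {k} → 0 < k → k < length u → rotateN k u ≢ u

least-period-∣ : ∀ {p} w → rotateN (suc p) w ≡ w → (∀ {r} → r < p → rotateN (suc r) w ≢ w) → suc p ∣ length w
least-period-∣ {p} w period minimal = m%n≡0⇒n∣m (length w) (suc p) remainder≡0
  where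
  remainder≡0 : length w % suc p ≡ 0
  remainder≡0 with length w % suc p | rotateN-%-period (length w) {suc p} period | m%n<n (length w) (suc p)
  ... | zero  | _ | _   = refl
  ... | suc s | e | s<p = contradiction (trans e (rotateN-length w)) (minimal (s≤s⁻¹ s<p))

period-power : ∀ {P} w q → length w ≡ suc q * P → rotateN P w ≡ w → ∃ λ u → length u ≡ P × w ≡ power (suc q) u
period-power {P} w q L≡ period = u , length-u , trans w≡u++v (cong (u ++_) v≡power)
  where
  u v : List ℕ
  u = take P w
  v = drop P w
  P≤L : P ≤ length w
  P≤L = subst (P ≤_) (sym L≡) (m≤m+n P (q * P))
  length-u : length u ≡ P
  length-u = trans (length-take P w) (m≤n⇒m⊓n≡m P≤L)
  length-v : length v ≡ q * length u
  length-v = begin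
    length v            ≡⟨ length-drop P w ⟩
    length w ∸ P        ≡⟨ cong (_∸ P) L≡ ⟩
    (P + q * P) ∸ P     ≡⟨ m+n∸m≡n P (q * P) ⟩
    q * P               ≡⟨ cong (q *_) length-u ⟨
    q * length u        ∎
  w≡u++v : w ≡ u ++ v
  w≡u++v = sym (take++drop≡id P w)
  v++u≡u++v : v ++ u ≡ u ++ v
  v++u≡u++v = begin
    v ++ u                        ≡⟨ rotateN-++ u v ⟨
    rotateN (length u) (u ++ v)   ≡⟨ cong₂ rotateN length-u (sym w≡u++v) ⟩
    rotateN P w                   ≡⟨ trans period w≡u++v ⟩
    u ++ v                        ∎
  v≡power : v ≡ power q u
  v≡power = ++-comm⇒power q u v length-v v++u≡u++v

primitive-root : ∀ w → ∃₂ λ d v → Primitive v × w ≡ power (suc d) v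
primitive-root [] = 0 , [] , (λ _ ()) , refl
primitive-root w@(x ∷ xs) with least (λ p → ≡-dec _≟_ (rotateN (suc p) w) w) {length xs} (rotateN-length w)
... | p , period , minimal with least-period-∣ w period minimal
...   | divides zero ()
...   | divides (suc q) L≡ with period-power w q L≡ period
...     | u , length-u , w≡ = q , u , u-primitive , w≡
  where
  u-primitive : Primitive u
  u-primitive {suc r} _ 1+r<P rotated = minimal (s≤s⁻¹ (subst (suc r <_) length-u 1+r<P)) (begin
    rotateN (suc r) w                   ≡⟨ cong (rotateN (suc r)) w≡ ⟩
    rotateN (suc r) (power (suc q) u)   ≡⟨ rotateN-power (suc r) (suc q) u ⟩
    power (suc q) (rotateN (suc r) u)   ≡⟨ cong (power (suc q)) rotated ⟩
    power (suc q) u                     ≡⟨ w≡ ⟨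
    w                                   ∎)

-- If v′ were shorter than v, rotating by |v′| would fix v^(d+1), hence v.
power-Primitive-length-≤ : ∀ d d′ {v v′} → Primitive v → 0 < length v′ →
                           power (suc d) v ≡ power (suc d′) v′ → length v ≤ length v′
power-Primitive-length-≤ d d′ {v} {v′} v-primitive 0<k e with length v′ <? length v
... | no  ¬shorter = ≮⇒≥ ¬shorter
... | yes shorter  = contradiction v-fixed (v-primitive 0<k shorter)
  where
  k : ℕ
  k = length v′
  v-fixed : rotateN k v ≡ v
  v-fixed = power-injective d (length-rotateN k v) (begin
    power (suc d) (rotateN k v)   ≡⟨ rotateN-power k (suc d) v ⟨
    rotateN k (power (suc d) v)   ≡⟨ cong (rotateN k) e ⟩
    rotateN k (power (suc d′) v′) ≡⟨ rotateN-power k (suc d′) v′ ⟩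
    power (suc d′) (rotateN k v′) ≡⟨ cong (power (suc d′)) (rotateN-length v′) ⟩
    power (suc d′) v′             ≡⟨ e ⟨
    power (suc d) v               ∎)

primitive-root-unique : ∀ d d′ {v v′} → Primitive v → Primitive v′ → 0 < length v → 0 < length v′ →
                        power (suc d) v ≡ power (suc d′) v′ → d ≡ d′ × v ≡ v′
primitive-root-unique d d′ {v} {v′} v-primitive v′-primitive 0<v 0<v′ e = d≡d′ , v≡v′
  where
  same-length : length v ≡ length v′
  same-length = ≤-antisym (power-Primitive-length-≤ d d′ v-primitive 0<v′ e)
                          (power-Primitive-length-≤ d′ d v′-primitive 0<v (sym e))
  v≡v′ : v ≡ v′
  v≡v′ = proj₁ (++-injective v v′ same-length e)
  d≡d′ : d ≡ d′
  d≡d′ = suc-injective (*-cancelʳ-≡ (suc d) (suc d′) (length v) {{>-nonZero 0<v}} (begin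
    suc d * length v       ≡⟨ length-power (suc d) v ⟨
    length (power (suc d) v) ≡⟨ cong length e ⟩
    length (power (suc d′) v′) ≡⟨ length-power (suc d′) v′ ⟩
    suc d′ * length v′     ≡⟨ cong (suc d′ *_) same-length ⟨
    suc d′ * length v      ∎))

Primitive-rotateN : ∀ j {u} → Primitive u → Primitive (rotateN j u)
Primitive-rotateN j {[]} _ _ k<0 = contradiction (subst (_ <_) (length-rotateN j []) k<0) λ ()
Primitive-rotateN j {u@(_ ∷ _)} u-primitive {k} 0<k k<L rotated =
  u-primitive 0<k (subst (k <_) (length-rotateN j u) k<L) (begin
    rotateN k u                                   ≡⟨ cong (rotateN k) (rotateN-∸-inverse u i≤L) ⟨
    rotateN k (rotateN (length u ∸ i) (rotateN i u)) ≡⟨ rotateN-comm k (length u ∸ i) _ ⟩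
    rotateN (length u ∸ i) (rotateN k (rotateN i u)) ≡⟨ cong (λ z → rotateN (length u ∸ i) (rotateN k z)) (rotateN-% j u) ⟩
    rotateN (length u ∸ i) (rotateN k (rotateN j u)) ≡⟨ cong (rotateN (length u ∸ i)) rotated ⟩
    rotateN (length u ∸ i) (rotateN j u)          ≡⟨ cong (rotateN (length u ∸ i)) (rotateN-% j u) ⟨
    rotateN (length u ∸ i) (rotateN i u)          ≡⟨ rotateN-∸-inverse u i≤L ⟩
    u                                             ∎)
  where
  i : ℕ
  i = j % length u
  i≤L : i ≤ length u
  i≤L = <⇒≤ (m%n<n j (length u))

rotateN-injective : ∀ {u i j} → Primitive u → i < j → j < length u → rotateN i u ≢ rotateN j u
rotateN-injective {u} {i} {j} u-primitive i<j j<L e =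
  Primitive-rotateN i u-primitive (m<n⇒0<n∸m i<j)
    (subst ((j ∸ i) <_) (sym (length-rotateN i u)) (≤-<-trans (m∸n≤m j i) j<L)) (begin
      rotateN (j ∸ i) (rotateN i u) ≡⟨ rotateN-+ i (j ∸ i) u ⟨
      rotateN (i + (j ∸ i)) u       ≡⟨ cong (λ k → rotateN k u) (m+[n∸m]≡n (<⇒≤ i<j)) ⟩
      rotateN j u                   ≡⟨ e ⟨
      rotateN i u                   ∎)

module _ {A : Set} (_≟ᴬ_ : DecidableEquality A) where

  deduplicate-Unique : ∀ {xs} → Unique xs → deduplicate _≟ᴬ_ xs ≡ xs
  deduplicate-Unique {[]}     _            = refl
  deduplicate-Unique {x ∷ xs} (x∉xs ∷ xs!) = cong (x ∷_) (begin
    filter (λ y → ¬? (x ≟ᴬ y)) (deduplicate _≟ᴬ_ xs) ≡⟨ cong (filter _) (deduplicate-Unique xs!) ⟩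
    filter (λ y → ¬? (x ≟ᴬ y)) xs                    ≡⟨ filter-all (λ y → ¬? (x ≟ᴬ y)) x∉xs ⟩
    xs                                               ∎)

  length-deduplicate-< : ∀ {x xs} → x ∈ xs → length (deduplicate _≟ᴬ_ (x ∷ xs)) < length (x ∷ xs)
  length-deduplicate-< {x} {xs} x∈xs = s≤s (<-≤-trans
    (filter-notAll (λ y → ¬? (x ≟ᴬ y)) _ (Any.map (λ { refl x≢x → x≢x refl }) (∈-deduplicate⁺ _≟ᴬ_ x∈xs)))
    (length-deduplicate _≟ᴬ_ xs))

rotations≡applyUpTo : ∀ u → rotations u ≡ applyUpTo (λ k → rotateN k u) (length u)
rotations≡applyUpTo u = map-applyUpTo id (λ k → rotateN k u) (length u)

length-rotations : ∀ u → length (rotations u) ≡ length u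
length-rotations u = trans (length-map (λ k → rotateN k u) (upTo (length u))) (length-upTo (length u))

Primitive⇒primitive? : ∀ {u} → Primitive u → T (primitive? u)
Primitive⇒primitive? {u} u-primitive = fromWitness (begin
  length (deduplicate (≡-dec _≟_) (rotations u)) ≡⟨ cong length (deduplicate-Unique (≡-dec _≟_) rotations!) ⟩
  length (rotations u)                           ≡⟨ length-rotations u ⟩
  length u                                       ∎)
  where
  rotations! : Unique (rotations u)
  rotations! = subst Unique (sym (rotations≡applyUpTo u))
    (applyUpTo⁺₁ (λ k → rotateN k u) (length u) (rotateN-injective u-primitive))

primitive?⇒Primitive : ∀ {u} → T (primitive? u) → Primitive u
primitive?⇒Primitive {x ∷ xs} ord≡L {suc k} _ k<L rotated = <⇒≢ ord<L (toWitness ord≡L)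
  where
  u : List ℕ
  u = x ∷ xs
  later : List (List ℕ)
  later = applyUpTo (λ j → rotateN (suc j) u) (length xs)
  ord<L : ord u < length u
  ord<L = subst₂ _<_
    (cong (λ us → length (deduplicate (≡-dec _≟_) us)) (sym (rotations≡applyUpTo u)))
    (cong suc (length-applyUpTo _ (length xs)))
    (length-deduplicate-< (≡-dec _≟_) (subst (_∈ later) rotated (∈-applyUpTo⁺ _ (s≤s⁻¹ k<L))))

rotateN-inverse : ∀ j {x xs} → ∃ λ r → r < length (x ∷ xs) × rotateN r (rotateN j (x ∷ xs)) ≡ x ∷ xs
rotateN-inverse j {x} {xs} = (L ∸ i) % L , m%n<n (L ∸ i) L , (begin
  rotateN ((L ∸ i) % L) (rotateN j u) ≡⟨ rotateN-%-period (L ∸ i) {L} period ⟩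
  rotateN (L ∸ i) (rotateN j u)       ≡⟨ cong (rotateN (L ∸ i)) (rotateN-% j u) ⟨
  rotateN (L ∸ i) (rotateN i u)       ≡⟨ rotateN-∸-inverse u (<⇒≤ (m%n<n j L)) ⟩
  u                                   ∎)
  where
  u : List ℕ
  u = x ∷ xs
  L i : ℕ
  L = length u
  i = j % L
  period : rotateN L (rotateN j u) ≡ rotateN j u
  period = subst (λ k → rotateN k (rotateN j u) ≡ rotateN j u) (length-rotateN j u) (rotateN-length (rotateN j u))

-- Lexicographically least rotations

_≤ˡ_ : List ℕ → List ℕ → Set
u ≤ˡ v = T (lexLeq u v)

≤ˡ-∷-< : ∀ {x y} xs ys → x < y → (x ∷ xs) ≤ˡ (y ∷ ys)
≤ˡ-∷-< {x} {y} _ _ x<y with x ≟ y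
... | yes x≡y = contradiction x≡y (<⇒≢ x<y)
... | no  _   = <⇒<ᵇ x<y

≤ˡ-∷-> : ∀ {x y} xs ys → y < x → ¬ (x ∷ xs) ≤ˡ (y ∷ ys)
≤ˡ-∷-> {x} {y} _ _ y<x with x ≟ y
... | yes x≡y = contradiction (sym x≡y) (<⇒≢ y<x)
... | no  _   = λ x<ᵇy → <⇒≯ (<ᵇ⇒< x y x<ᵇy) y<x

lexLeq-∷-≡ : ∀ x xs ys → lexLeq (x ∷ xs) (x ∷ ys) ≡ lexLeq xs ys
lexLeq-∷-≡ x xs ys with x ≟ x
... | yes _   = refl
... | no  x≢x = contradiction refl x≢x

≤ˡ-refl : ∀ xs → xs ≤ˡ xs
≤ˡ-refl []       = _
≤ˡ-refl (x ∷ xs) = subst T (sym (lexLeq-∷-≡ x xs xs)) (≤ˡ-refl xs)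

≤ˡ-total : ∀ xs ys → xs ≤ˡ ys ⊎ ys ≤ˡ xs
≤ˡ-total []       _        = inj₁ _
≤ˡ-total (_ ∷ _)  []       = inj₂ _
≤ˡ-total (x ∷ xs) (y ∷ ys) with <-cmp x y
... | tri< x<y _ _ = inj₁ (≤ˡ-∷-< xs ys x<y)
... | tri> _ _ y<x = inj₂ (≤ˡ-∷-< ys xs y<x)
... | tri≈ _ refl _ with ≤ˡ-total xs ys
...   | inj₁ xs≤ys = inj₁ (subst T (sym (lexLeq-∷-≡ x xs ys)) xs≤ys)
...   | inj₂ ys≤xs = inj₂ (subst T (sym (lexLeq-∷-≡ x ys xs)) ys≤xs)

≤ˡ-∷⁻ : ∀ x y xs ys → (x ∷ xs) ≤ˡ (y ∷ ys) → x < y ⊎ (x ≡ y × xs ≤ˡ ys)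
≤ˡ-∷⁻ x y xs ys le with <-cmp x y
... | tri< x<y _ _  = inj₁ x<y
... | tri≈ _ refl _ = inj₂ (refl , subst T (lexLeq-∷-≡ x xs ys) le)
... | tri> _ _ y<x  = contradiction le (≤ˡ-∷-> xs ys y<x)

≤ˡ-antisym : ∀ xs ys → xs ≤ˡ ys → ys ≤ˡ xs → xs ≡ ys
≤ˡ-antisym []       []       _ _ = refl
≤ˡ-antisym (x ∷ xs) (y ∷ ys) le ge with ≤ˡ-∷⁻ x y xs ys le | ≤ˡ-∷⁻ y x ys xs ge
... | inj₁ x<y            | inj₁ y<x            = contradiction x<y (<⇒≯ y<x)
... | inj₁ x<y            | inj₂ (refl , _)     = contradiction refl (<⇒≢ x<y)
... | inj₂ (refl , _)     | inj₁ y<x            = contradiction refl (<⇒≢ y<x)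
... | inj₂ (refl , xs≤ys) | inj₂ (_ , ys≤xs)    = cong (x ∷_) (≤ˡ-antisym xs ys xs≤ys ys≤xs)

≤ˡ-trans : ∀ xs ys zs → xs ≤ˡ ys → ys ≤ˡ zs → xs ≤ˡ zs
≤ˡ-trans []       _        _        _   _   = _
≤ˡ-trans (x ∷ xs) (y ∷ ys) (z ∷ zs) le₁ le₂ with ≤ˡ-∷⁻ x y xs ys le₁ | ≤ˡ-∷⁻ y z ys zs le₂
... | inj₁ x<y            | inj₁ y<z            = ≤ˡ-∷-< xs zs (<-trans x<y y<z)
... | inj₁ x<y            | inj₂ (refl , _)     = ≤ˡ-∷-< xs zs x<y
... | inj₂ (refl , _)     | inj₁ y<z            = ≤ˡ-∷-< xs zs y<z
... | inj₂ (refl , xs≤ys) | inj₂ (refl , ys≤zs) = subst T (sym (lexLeq-∷-≡ x xs zs)) (≤ˡ-trans xs ys zs xs≤ys ys≤zs)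

≤ˡ-minimum : ∀ x xs → ∃ λ m → m ∈ x ∷ xs × All (m ≤ˡ_) (x ∷ xs)
≤ˡ-minimum x []        = x , here refl , ≤ˡ-refl x ∷ []
≤ˡ-minimum x (y ∷ ys) with ≤ˡ-minimum y ys
... | m , m∈ , m≤ with ≤ˡ-total x m
...   | inj₁ x≤m = x , here refl , ≤ˡ-refl x ∷ All.map (λ {z} → ≤ˡ-trans x m z x≤m) m≤
...   | inj₂ m≤x = m , there m∈ , m≤x ∷ m≤

rotateN-∈-rotations : ∀ k {x xs} → rotateN k (x ∷ xs) ∈ rotations (x ∷ xs)
rotateN-∈-rotations k {x} {xs} = subst (_∈ rotations u) (rotateN-% k u)
  (∈-map⁺ (λ j → rotateN j u) (∈-upTo⁺ (m%n<n k (length u))))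
  where
  u : List ℕ
  u = x ∷ xs

∈-rotations⁻ : ∀ {y} u → y ∈ rotations u → ∃ λ k → k < length u × y ≡ rotateN k u
∈-rotations⁻ u y∈ with ∈-map⁻ (λ j → rotateN j u) y∈
... | k , k∈ , y≡ = k , ∈-upTo⁻ k∈ , y≡

isRep⇒≤ˡ-rotateN : ∀ μ → T (isRep μ) → ∀ k → μ ≤ˡ rotateN k μ
isRep⇒≤ˡ-rotateN []       _   k = _
isRep⇒≤ˡ-rotateN (x ∷ xs) rep k = All.lookup (all⁺ (lexLeq (x ∷ xs)) (rotations (x ∷ xs)) rep) (rotateN-∈-rotations k)

isRep-rotateN : ∀ x xs → ∃ λ r → r < length (x ∷ xs) × T (isRep (rotateN r (x ∷ xs)))
isRep-rotateN x xs with ≤ˡ-minimum (x ∷ xs) (map (λ k → rotateN k (x ∷ xs)) (applyUpTo suc (length xs)))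
... | m , m∈ , m≤ with ∈-rotations⁻ (x ∷ xs) m∈
...   | r , r<L , refl = r , r<L , all⁻ (lexLeq μ) (All.tabulate μ≤)
  where
  u μ : List ℕ
  u = x ∷ xs
  μ = rotateN r u
  μ≤ : ∀ {y} → y ∈ rotations μ → μ ≤ˡ y
  μ≤ y∈ with ∈-rotations⁻ μ y∈
  ... | j , _ , refl = All.lookup m≤ (subst (_∈ rotations u) (rotateN-+ r j u) (rotateN-∈-rotations (r + j)))

isRep-unique : ∀ {μ μ′} k → 0 < length μ → T (isRep μ) → T (isRep μ′) → μ′ ≡ rotateN k μ → μ ≡ μ′
isRep-unique {μ@(_ ∷ _)} {μ′} k _ rep rep′ refl =
  ≤ˡ-antisym μ μ′ (isRep⇒≤ˡ-rotateN μ rep k) (subst (μ′ ≤ˡ_) back (isRep⇒≤ˡ-rotateN μ′ rep′ (length μ ∸ j)))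
  where
  j : ℕ
  j = k % length μ
  back : rotateN (length μ ∸ j) μ′ ≡ μ
  back = trans (cong (rotateN (length μ ∸ j)) (sym (rotateN-% k μ))) (rotateN-∸-inverse μ (<⇒≤ (m%n<n k (length μ))))

module _ {A B : Set} (f : A → List B) where

  ∈-concatMap⁺′ : ∀ {x xs y} → x ∈ xs → y ∈ f x → y ∈ concatMap f xs
  ∈-concatMap⁺′ x∈ y∈ = ∈-concatMap⁺ f (lose x∈ y∈)

  ∈-concatMap⁻′ : ∀ xs {y} → y ∈ concatMap f xs → ∃ λ x → x ∈ xs × y ∈ f x
  ∈-concatMap⁻′ xs y∈ = find (∈-concatMap⁻ f {xs = xs} y∈)

  concatMap⁺ : ∀ {xs} → Unique xs → (∀ {x} → x ∈ xs → Unique (f x)) →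
               (∀ {x x′ y} → x ∈ xs → x′ ∈ xs → y ∈ f x → y ∈ f x′ → x ≡ x′) →
               Unique (concatMap f xs)
  concatMap⁺ {[]}     _            _  _        = []
  concatMap⁺ {x ∷ xs} (x∉xs ∷ xs!) f! disjoint = ++⁺ (f! (here refl))
    (concatMap⁺ xs! (λ x∈ → f! (there x∈)) (λ x∈ x′∈ → disjoint (there x∈) (there x′∈)))
    λ (y∈fx , y∈rest) → let x′ , x′∈ , y∈fx′ = ∈-concatMap⁻′ xs y∈rest in
      All.lookup x∉xs x′∈ (disjoint (here refl) (there x′∈) y∈fx y∈fx′)

map⁺-local : ∀ {A B : Set} (f : A → B) {xs} → Unique xs →
             (∀ {x y} → x ∈ xs → y ∈ xs → f x ≡ f y → x ≡ y) → Unique (map f xs)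
map⁺-local f {[]}     _            _   = []
map⁺-local f {x ∷ xs} (x∉xs ∷ xs!) inj =
  Allₚ.map⁺ (All.tabulate λ {y} y∈ fx≡fy → All.lookup x∉xs y∈ (inj (here refl) (there y∈) fx≡fy))
  ∷ map⁺-local f xs! (λ x∈ y∈ → inj (there x∈) (there y∈))

-- Compositions

IsComposition : ℕ → List ℕ → Set
IsComposition m w = All (0 <_) w × sum w ≡ m

extend : List ℕ → List (List ℕ)
extend []       = (1 ∷ []) ∷ []
extend (k ∷ ks) = (1 ∷ k ∷ ks) ∷ (suc k ∷ ks) ∷ []

compositions-suc : ∀ m → compositions (suc m) ≡ concatMap extend (compositions m)
compositions-suc m = concatMap-cong (λ { [] → refl ; (_ ∷ _) → refl }) (compositions m)

∈-compositions⁻ : ∀ m {w} → w ∈ compositions m → IsComposition m w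
∈-compositions⁻ zero    (here refl) = [] , refl
∈-compositions⁻ (suc m) w∈ with ∈-concatMap⁻′ extend (compositions m) (subst (_ ∈_) (compositions-suc m) w∈)
... | [] , v∈ , here refl with ∈-compositions⁻ m v∈
...   | _ , refl = s≤s z≤n ∷ [] , refl
∈-compositions⁻ (suc m) w∈ | _ ∷ _ , v∈ , here refl with ∈-compositions⁻ m v∈
...   | positive , refl = s≤s z≤n ∷ positive , refl
∈-compositions⁻ (suc m) w∈ | _ ∷ _ , v∈ , there (here refl) with ∈-compositions⁻ m v∈
...   | _ ∷ positive , refl = s≤s z≤n ∷ positive , refl

∈-compositions⁺ : ∀ m {w} → IsComposition m w → w ∈ compositions m
∈-compositions⁺ zero    {[]}    _                  = here refl
∈-compositions⁺ zero    {_ ∷ _} (s≤s _ ∷ _ , ())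
∈-compositions⁺ (suc m) {w}     w-composition      = subst (w ∈_) (sym (compositions-suc m)) (extended w w-composition)
  where
  extended : ∀ w → IsComposition (suc m) w → w ∈ concatMap extend (compositions m)
  extended (1 ∷ [])           (_ , refl)       = ∈-concatMap⁺′ extend (∈-compositions⁺ m ([] , refl)) (here refl)
  extended (1 ∷ k ∷ ks)       (_ ∷ pos , sum≡) = ∈-concatMap⁺′ extend (∈-compositions⁺ m (pos , suc-injective sum≡)) (here refl)
  extended (suc (suc k) ∷ ks) (_ ∷ pos , sum≡) =
    ∈-concatMap⁺′ extend (∈-compositions⁺ m (s≤s z≤n ∷ pos , suc-injective sum≡)) (there (here refl))

shrink : List ℕ → List ℕ
shrink (suc (suc k) ∷ ks) = suc k ∷ ks
shrink (_ ∷ ks)           = ks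
shrink []                 = []

compositions-Unique : ∀ m → Unique (compositions m)
compositions-Unique zero    = [] ∷ []
compositions-Unique (suc m) = subst Unique (sym (compositions-suc m))
  (concatMap⁺ extend (compositions-Unique m) extend-Unique
    λ v∈ v′∈ w∈ w∈′ → trans (sym (shrink-extend v∈ w∈)) (shrink-extend v′∈ w∈′))
  where
  extend-Unique : ∀ {v} → v ∈ compositions m → Unique (extend v)
  extend-Unique {[]}    _  = [] ∷ []
  extend-Unique {_ ∷ _} v∈ with ∈-compositions⁻ m v∈
  ... | s≤s _ ∷ _ , _ = ((λ ()) ∷ []) ∷ [] ∷ []
  shrink-extend : ∀ {v w} → v ∈ compositions m → w ∈ extend v → shrink w ≡ v
  shrink-extend {[]}    _  (here refl)         = refl
  shrink-extend {_ ∷ _} _  (here refl)         = refl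
  shrink-extend {_ ∷ _} v∈ (there (here refl)) with ∈-compositions⁻ m v∈
  ... | s≤s _ ∷ _ , _ = refl

sum-rotate : ∀ u → sum (rotate u) ≡ sum u
sum-rotate []       = refl
sum-rotate (x ∷ xs) = trans (sum-++ xs (x ∷ [])) (trans (cong (_+_ (sum xs)) (+-identityʳ x)) (+-comm (sum xs) x))

sum-rotateN : ∀ k u → sum (rotateN k u) ≡ sum u
sum-rotateN zero    u = refl
sum-rotateN (suc k) u = trans (sum-rotateN k (rotate u)) (sum-rotate u)

All-rotateN : ∀ {P : ℕ → Set} k {u} → All P u → All P (rotateN k u)
All-rotateN zero    Pu                  = Pu
All-rotateN (suc k) {[]}     []         = All-rotateN k []
All-rotateN (suc k) {x ∷ xs} (Px ∷ Pxs) = All-rotateN k (Allₚ.++⁺ Pxs (Px ∷ []))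

sum-power : ∀ d u → sum (power d u) ≡ d * sum u
sum-power zero    u = refl
sum-power (suc d) u = trans (sum-++ u (power d u)) (cong (_+_ (sum u)) (sum-power d u))

All-power : ∀ {P : ℕ → Set} d {u} → All P u → All P (power d u)
All-power zero    _  = []
All-power (suc d) Pu = Allₚ.++⁺ Pu (All-power d Pu)

IsComposition-rotateN : ∀ k {m u} → IsComposition m u → IsComposition m (rotateN k u)
IsComposition-rotateN k {u = u} (positive , sum≡) = All-rotateN k positive , trans (sum-rotateN k u) sum≡

IsComposition-power : ∀ d {m u} → IsComposition m u → IsComposition (d * m) (power d u)
IsComposition-power d {u = u} (positive , refl) = All-power d positive , sum-power d u

IsComposition-power⁻ : ∀ d {m u} → IsComposition m (power (suc d) u) → IsComposition (sum u) u × m ≡ suc d * sum u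
IsComposition-power⁻ d {u = u} (positive , sum≡) = (Allₚ.++⁻ˡ u positive , refl) , trans (sym sum≡) (sum-power (suc d) u)

IsComposition-nonempty : ∀ {m w} → 0 < m → IsComposition m w → 0 < length w
IsComposition-nonempty 0<m ([] , refl) = 0<m
IsComposition-nonempty 0<m (_ ∷ _ , _) = s≤s z≤n

-- Sums of fractions

-- a /1+ b = a/(b+1): shifting the denominator avoids NonZero side conditions.
_/1+_ : ℕ → ℕ → ℚ
a /1+ b = + a ℚ./ suc b

/1+-≡ : ∀ a b c d → a * suc d ≡ c * suc b → a /1+ b ≡ c /1+ d
/1+-≡ a b c d e = ℚ.fromℚᵘ-cong {mkℚᵘ (+ a) b} {mkℚᵘ (+ c) d}
  (*≡* (trans (sym (ℤ.pos-* a (suc d))) (trans (cong +_ e) (ℤ.pos-* c (suc b)))))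

+-*-cross : ∀ a c s → (+ a ℤ.* + s ℤ.+ + c ℤ.* + s) ℤ.* + s ≡ + (a + c) ℤ.* + (s * s)
+-*-cross a c s = begin
  (+ a ℤ.* + s ℤ.+ + c ℤ.* + s) ℤ.* + s   ≡⟨ cong₂ (λ x y → (x ℤ.+ y) ℤ.* + s) (ℤ.pos-* a s) (ℤ.pos-* c s) ⟨
  (+ (a * s) ℤ.+ + (c * s)) ℤ.* + s   ≡⟨ cong (ℤ._* + s) (ℤ.pos-+ (a * s) (c * s)) ⟨
  + (a * s + c * s) ℤ.* + s         ≡⟨ ℤ.pos-* (a * s + c * s) s ⟨
  + ((a * s + c * s) * s)         ≡⟨ cong +_ (identity a c s) ⟩
  + ((a + c) * (s * s))             ≡⟨ ℤ.pos-* (a + c) (s * s) ⟩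
  + (a + c) ℤ.* + (s * s)             ∎
  where
  identity : ∀ a c s → (a * s + c * s) * s ≡ (a + c) * (s * s)
  identity = solve-∀

/1+-+ : ∀ a c b → a /1+ b ℚ.+ c /1+ b ≡ (a + c) /1+ b
/1+-+ a c b = ℚ.toℚᵘ-injective (begin≃
  ℚ.toℚᵘ (a /1+ b ℚ.+ c /1+ b)             ≈⟨ ℚ.toℚᵘ-homo-+ (a /1+ b) (c /1+ b) ⟩
  ℚ.toℚᵘ (a /1+ b) ℚᵘ.+ ℚ.toℚᵘ (c /1+ b)   ≈⟨ ℚᵘ.+-cong (ℚ.toℚᵘ-fromℚᵘ (mkℚᵘ (+ a) b)) (ℚ.toℚᵘ-fromℚᵘ (mkℚᵘ (+ c) b)) ⟩
  mkℚᵘ (+ a) b ℚᵘ.+ mkℚᵘ (+ c) b           ≈⟨ *≡* (+-*-cross a c (suc b)) ⟩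
  mkℚᵘ (+ (a + c)) b                     ≈⟨ ℚᵘ.≃-sym (ℚ.toℚᵘ-fromℚᵘ (mkℚᵘ (+ (a + c)) b)) ⟩
  ℚ.toℚᵘ ((a + c) /1+ b)                 ∎≃)
  where open ℚᵘ.≃-Reasoning renaming (begin_ to begin≃_; _∎ to _∎≃)

0/1+ : ∀ b → 0 /1+ b ≡ 0ℚ
0/1+ b = /1+-≡ 0 b 0 0 refl

sumℚ-++ : ∀ xs ys → sumℚ (xs ++ ys) ≡ sumℚ xs ℚ.+ sumℚ ys
sumℚ-++ []       ys = sym (ℚ.+-identityˡ _)
sumℚ-++ (x ∷ xs) ys = trans (cong (x ℚ.+_) (sumℚ-++ xs ys)) (sym (ℚ.+-assoc x _ _))

sumℚ-concatMap : ∀ {A B : Set} (g : B → ℚ) (f : A → List B) xs →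
                 sumℚ (map g (concatMap f xs)) ≡ sumℚ (map (λ x → sumℚ (map g (f x))) xs)
sumℚ-concatMap g f []       = refl
sumℚ-concatMap g f (x ∷ xs) = begin
  sumℚ (map g (f x ++ concatMap f xs))                       ≡⟨ cong sumℚ (map-++ g (f x) _) ⟩
  sumℚ (map g (f x) ++ map g (concatMap f xs))               ≡⟨ sumℚ-++ (map g (f x)) _ ⟩
  sumℚ (map g (f x)) ℚ.+ sumℚ (map g (concatMap f xs))       ≡⟨ cong (sumℚ (map g (f x)) ℚ.+_) (sumℚ-concatMap g f xs) ⟩
  sumℚ (map g (f x)) ℚ.+ sumℚ (map (λ x → sumℚ (map g (f x))) xs) ∎

sumℚ-+ : ∀ {A : Set} (f g : A → ℚ) xs →
         sumℚ (map (λ x → f x ℚ.+ g x) xs) ≡ sumℚ (map f xs) ℚ.+ sumℚ (map g xs)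
sumℚ-+ f g []       = sym (ℚ.+-identityˡ 0ℚ)
sumℚ-+ f g (x ∷ xs) = trans (cong ((f x ℚ.+ g x) ℚ.+_) (sumℚ-+ f g xs))
                            (interchange (f x) (g x) (sumℚ (map f xs)) (sumℚ (map g xs)))

sumℚ-const : ∀ {A : Set} a b (xs : List A) → sumℚ (map (λ _ → a /1+ b) xs) ≡ (length xs * a) /1+ b
sumℚ-const a b []       = sym (0/1+ b)
sumℚ-const a b (x ∷ xs) = trans (cong (a /1+ b ℚ.+_) (sumℚ-const a b xs)) (/1+-+ a _ b)

sumℚ-Unique : ∀ {A : Set} (f : A → ℚ) {xs ys} → Unique xs → Unique ys →
              (∀ {z} → z ∈ xs → z ∈ ys) → (∀ {z} → z ∈ ys → z ∈ xs) → sumℚ (map f xs) ≡ sumℚ (map f ys)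
sumℚ-Unique f xs! ys! xs⊆ys ys⊆xs =
  foldr-commMonoid +-0.setoid +-0.isCommutativeMonoid
    (↭⇒↭ₛ (↭.map⁺ f (∼bag⇒↭ (unique∧set⇒bag xs! ys! (mk⇔ xs⊆ys ys⊆xs)))))
  where module +-0 = CommutativeMonoid ℚ.+-0-commutativeMonoid

-- Binomial sums and the Catalan numbers

module _ {A : Set} (_∙_ : A → A → A) where

  -- binomialTransform _∙_ m a = ∑ⱼ (m C j) · a j, computed by Pascal's rule.
  binomialTransform : ℕ → (ℕ → A) → A
  binomialTransform zero    a = a 0
  binomialTransform (suc m) a = binomialTransform m a ∙ binomialTransform m (a ∘ suc)

  binomialTransform-cong : ∀ m {a b} → (∀ j → a j ≡ b j) → binomialTransform m a ≡ binomialTransform m b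
  binomialTransform-cong zero    a≗b = a≗b 0
  binomialTransform-cong (suc m) a≗b =
    cong₂ _∙_ (binomialTransform-cong m a≗b) (binomialTransform-cong m (a≗b ∘ suc))

binomialTransform-homo : ∀ {A B : Set} {_∙_ : A → A → A} {_◦_ : B → B → B} (f : A → B) →
                         (∀ x y → f (x ∙ y) ≡ f x ◦ f y) →
                         ∀ m a → f (binomialTransform _∙_ m a) ≡ binomialTransform _◦_ m (f ∘ a)
binomialTransform-homo f homo zero    a = refl
binomialTransform-homo {_◦_ = _◦_} f homo (suc m) a =
  trans (homo _ _) (cong₂ _◦_ (binomialTransform-homo f homo m a) (binomialTransform-homo f homo m (a ∘ suc)))

vandermonde : ∀ m b k → binomialTransform _+_ m (λ j → b C (j + k)) ≡ (m + b) C (m + k)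
vandermonde zero    b k = refl
vandermonde (suc m) b k = begin
  binomialTransform _+_ m (λ j → b C (j + k)) + binomialTransform _+_ m (λ j → b C (suc j + k))
    ≡⟨ cong₂ _+_ (vandermonde m b k)
                 (trans (binomialTransform-cong _+_ m (λ j → cong (b C_) (sym (+-suc j k)))) (vandermonde m b (suc k))) ⟩
  (m + b) C (m + k) + (m + b) C (m + suc k)   ≡⟨ cong (λ i → (m + b) C (m + k) + (m + b) C i) (+-suc m k) ⟩
  (m + b) C (m + k) + (m + b) C suc (m + k)   ≡⟨ nCk+nC[k+1]≡[n+1]C[k+1] (m + b) (m + k) ⟩
  suc (m + b) C suc (m + k)                   ∎

[k+1]*[n+1]C[k+1]≡[n+1]*nCk : ∀ n k → suc k * (suc n C suc k) ≡ suc n * (n C k)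
[k+1]*[n+1]C[k+1]≡[n+1]*nCk zero    zero    = refl
[k+1]*[n+1]C[k+1]≡[n+1]*nCk zero    (suc k)
  rewrite k>n⇒nCk≡0 {1} {suc (suc k)} (s≤s (s≤s z≤n)) | k>n⇒nCk≡0 {0} {suc k} (s≤s z≤n) = *-zeroʳ (suc (suc k))
[k+1]*[n+1]C[k+1]≡[n+1]*nCk (suc n) zero
  rewrite nC1≡n (suc (suc n)) = identity n
  where
  identity : ∀ n → 2 + n + 0 ≡ 2 + n * 1
  identity = solve-∀
[k+1]*[n+1]C[k+1]≡[n+1]*nCk (suc n) (suc k) = begin
  suc (suc k) * (suc N C suc (suc k))     ≡⟨ cong (suc (suc k) *_) (nCk+nC[k+1]≡[n+1]C[k+1] N (suc k)) ⟨
  suc (suc k) * (A + B)                   ≡⟨ split (suc k) A B ⟩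
  A + suc k * A + suc (suc k) * B         ≡⟨ cong₂ (λ x y → A + x + y) ([k+1]*[n+1]C[k+1]≡[n+1]*nCk n k)
                                                                   ([k+1]*[n+1]C[k+1]≡[n+1]*nCk n (suc k)) ⟩
  A + N * (n C k) + N * (n C suc k)       ≡⟨ merge A N (n C k) (n C suc k) ⟩
  A + N * (n C k + n C suc k)             ≡⟨ cong (λ x → A + N * x) (nCk+nC[k+1]≡[n+1]C[k+1] n k) ⟩
  suc N * A                               ∎
  where
  N A B : ℕ
  N = suc n
  A = N C suc k
  B = N C suc (suc k)
  split : ∀ k A B → suc k * (A + B) ≡ A + k * A + suc k * B
  split = solve-∀
  merge : ∀ A N x y → A + N * x + N * y ≡ A + N * (x + y)
  merge = solve-∀

sumℚ-compositions : ∀ m (h : ℕ → ℚ) →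
                    sumℚ (map (h ∘ length) (compositions (suc m))) ≡ binomialTransform ℚ._+_ m (h ∘ suc)
sumℚ-compositions zero    h = ℚ.+-identityʳ (h 1)
sumℚ-compositions (suc m) h = begin
  sumℚ (map H (compositions (suc (suc m))))        ≡⟨ cong (sumℚ ∘ map H) (compositions-suc (suc m)) ⟩
  sumℚ (map H (concatMap extend cs))               ≡⟨ sumℚ-concatMap H extend cs ⟩
  sumℚ (map (λ v → sumℚ (map H (extend v))) cs)    ≡⟨ cong sumℚ (map-cong-local (All.tabulate extend-weights)) ⟩
  sumℚ (map (λ v → H′ v ℚ.+ H v) cs)               ≡⟨ sumℚ-+ H′ H cs ⟩
  sumℚ (map H′ cs) ℚ.+ sumℚ (map H cs)
    ≡⟨ cong₂ ℚ._+_ (sumℚ-compositions m (h ∘ suc)) (sumℚ-compositions m h) ⟩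
  binomialTransform ℚ._+_ m (h ∘ suc ∘ suc) ℚ.+ binomialTransform ℚ._+_ m (h ∘ suc)
    ≡⟨ ℚ.+-comm (binomialTransform ℚ._+_ m (h ∘ suc ∘ suc)) _ ⟩
  binomialTransform ℚ._+_ (suc m) (h ∘ suc)        ∎
  where
  cs : List (List ℕ)
  cs = compositions (suc m)
  H H′ : List ℕ → ℚ
  H  = h ∘ length
  H′ = h ∘ suc ∘ length
  extend-weights : ∀ {v} → v ∈ cs → sumℚ (map H (extend v)) ≡ H′ v ℚ.+ H v
  extend-weights {[]} v∈ with ∈-compositions⁻ (suc m) v∈
  ... | _ , ()
  extend-weights {v@(_ ∷ _)} _ = cong (H′ v ℚ.+_) (ℚ.+-identityʳ (H v))

weight : ℕ → ℕ → ℚ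
weight n k = (n C (k ∸ 1)) /1+ (k ∸ 1)

catalan≡sum-compositions : ∀ m → catalan (suc m) ≡ sumℚ (map (weight (suc m) ∘ length) (compositions (suc m)))
catalan≡sum-compositions m = sym (begin
  sumℚ (map (weight n ∘ length) (compositions n))
    ≡⟨ sumℚ-compositions m (weight n) ⟩
  binomialTransform ℚ._+_ m (λ j → (n C j) /1+ j)
    ≡⟨ binomialTransform-cong ℚ._+_ m (λ j → /1+-≡ (n C j) j (suc n C suc j) n (absorb j)) ⟩
  binomialTransform ℚ._+_ m (λ j → (suc n C suc j) /1+ n)
    ≡⟨ binomialTransform-homo (_/1+ n) (λ a c → sym (/1+-+ a c n)) m (λ j → suc n C suc j) ⟨
  binomialTransform _+_ m (λ j → suc n C suc j) /1+ n
    ≡⟨ cong (_/1+ n) (binomialTransform-cong _+_ m (λ j → cong (suc n C_) (+-comm 1 j))) ⟩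
  binomialTransform _+_ m (λ j → suc n C (j + 1)) /1+ n
    ≡⟨ cong (_/1+ n) (vandermonde m (suc n) 1) ⟩
  ((m + suc n) C (m + 1)) /1+ n
    ≡⟨ cong₂ (λ a k → (a C k) /1+ n) (double m) (+-comm m 1) ⟩
  catalan n ∎)
  where
  n : ℕ
  n = suc m
  absorb : ∀ j → (n C j) * suc n ≡ (suc n C suc j) * suc j
  absorb j = trans (*-comm (n C j) (suc n))
               (trans (sym ([k+1]*[n+1]C[k+1]≡[n+1]*nCk n j)) (*-comm (suc j) _))
  double : ∀ m → m + suc (suc m) ≡ 2 * suc m
  double = solve-∀

-- Factorisation of compositions into powers of rotated class representatives

module Factorisation (n : ℕ) where

  -- i ∈ divisors stands for the divisor i + 1 of n, as in rhs.
  divisors : List ℕ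
  divisors = filter (λ i → suc i ∣? n) (upTo n)

  primitiveClasses : ℕ → List (List ℕ)
  primitiveClasses i = filterᵇ primitive? (CComp (n / suc i))

  powersOfRotations : ℕ → List ℕ → List (List ℕ)
  powersOfRotations i μ = map (λ r → power (suc i) (rotateN r μ)) (upTo (length μ))

  powersOfClasses : ℕ → List (List ℕ)
  powersOfClasses i = concatMap (powersOfRotations i) (primitiveClasses i)

  factored : List (List ℕ)
  factored = concatMap powersOfClasses divisors

  ∈-divisors⁻ : ∀ {i} → i ∈ divisors → i < n × suc i ∣ n
  ∈-divisors⁻ i∈ = let i∈upTo , i+1∣n = ∈-filter⁻ (λ i → suc i ∣? n) i∈ in ∈-upTo⁻ i∈upTo , i+1∣n

  record PrimitiveClass (i : ℕ) (μ : List ℕ) : Set where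
    field
      composition : IsComposition (n / suc i) μ
      representative : T (isRep μ)
      isPrimitive : Primitive μ
      nonempty : 0 < length μ

  ∈-primitiveClasses⁻ : ∀ {i μ} → i ∈ divisors → μ ∈ primitiveClasses i → PrimitiveClass i μ
  ∈-primitiveClasses⁻ {i} {μ} i∈ μ∈ with ∈-filter⁻ (T? ∘ primitive?) μ∈
  ... | μ∈CComp , prim with ∈-filter⁻ (T? ∘ isRep) μ∈CComp
  ...   | μ∈comps , rep = record
    { composition    = composition
    ; representative = rep
    ; isPrimitive    = primitive?⇒Primitive prim
    ; nonempty       = IsComposition-nonempty (m≥n⇒m/n>0 (proj₁ (∈-divisors⁻ i∈))) composition
    }
    where
    composition : IsComposition (n / suc i) μ
    composition = ∈-compositions⁻ (n / suc i) μ∈comps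

  ∈-powersOfRotations⁻ : ∀ {i μ w} → w ∈ powersOfRotations i μ → ∃ λ r → r < length μ × w ≡ power (suc i) (rotateN r μ)
  ∈-powersOfRotations⁻ {i} {μ} w∈ with ∈-map⁻ (λ r → power (suc i) (rotateN r μ)) w∈
  ... | r , r∈ , w≡ = r , ∈-upTo⁻ r∈ , w≡

  ∈-powersOfClasses⁻ : ∀ {i w} → w ∈ powersOfClasses i →
    ∃₂ λ μ r → μ ∈ primitiveClasses i × r < length μ × w ≡ power (suc i) (rotateN r μ)
  ∈-powersOfClasses⁻ {i} w∈ with ∈-concatMap⁻′ (powersOfRotations i) (primitiveClasses i) w∈
  ... | μ , μ∈ , w∈′ with ∈-powersOfRotations⁻ {i} {μ} w∈′
  ...   | r , r< , w≡ = μ , r , μ∈ , r< , w≡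

  factored⊆compositions : ∀ {w} → w ∈ factored → w ∈ compositions n
  factored⊆compositions w∈ with ∈-concatMap⁻′ powersOfClasses divisors w∈
  ... | i , i∈ , w∈′ with ∈-powersOfClasses⁻ {i} w∈′
  ...   | μ , r , μ∈ , _ , refl = ∈-compositions⁺ n (subst (λ m → IsComposition m _) i+1*[n/i+1]≡n
    (IsComposition-power (suc i) (IsComposition-rotateN r (PrimitiveClass.composition (∈-primitiveClasses⁻ i∈ μ∈)))))
    where
    i+1*[n/i+1]≡n : suc i * (n / suc i) ≡ n
    i+1*[n/i+1]≡n = trans (*-comm (suc i) (n / suc i)) (m/n*n≡m (proj₂ (∈-divisors⁻ i∈)))

  power-∈-factored : 0 < n → ∀ d {v} → Primitive v → IsComposition n (power (suc d) v) → power (suc d) v ∈ factored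
  power-∈-factored 0<n d {[]} _ composition =
    contradiction (trans (proj₂ (IsComposition-power⁻ d composition)) (*-zeroʳ (suc d))) (>⇒≢ 0<n)
  power-∈-factored 0<n d {v@(x ∷ xs)} v-primitive composition =
    ∈-concatMap⁺′ _ d∈divisors (∈-concatMap⁺′ (powersOfRotations d) μ∈primitiveClasses
      (subst (_∈ powersOfRotations d μ) (cong (power (suc d)) μ-back) (∈-map⁺ _ (∈-upTo⁺ r<length))))
    where
    v-composition : IsComposition (sum v) v
    v-composition = proj₁ (IsComposition-power⁻ d composition)
    n≡ : n ≡ sum v * suc d
    n≡ = trans (proj₂ (IsComposition-power⁻ d composition)) (*-comm (suc d) (sum v))
    0<∑v : 0 < sum v
    0<∑v with proj₁ v-composition
    ... | 0<x ∷ _ = ≤-trans 0<x (m≤m+n x (sum xs))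
    d∈divisors : d ∈ divisors
    d∈divisors = ∈-filter⁺ (λ i → suc i ∣? n)
      (∈-upTo⁺ (subst (suc d ≤_) (sym n≡) (m≤n*m (suc d) (sum v) {{>-nonZero 0<∑v}}))) (divides (sum v) n≡)
    r₀ : ℕ
    r₀ = proj₁ (isRep-rotateN x xs)
    μ : List ℕ
    μ = rotateN r₀ v
    μ-composition : IsComposition (n / suc d) μ
    μ-composition = subst (λ m → IsComposition m μ) (sym (trans (cong (_/ suc d) n≡) (m*n/n≡m (sum v) (suc d))))
                          (IsComposition-rotateN r₀ v-composition)
    μ∈primitiveClasses : μ ∈ primitiveClasses d
    μ∈primitiveClasses = ∈-filter⁺ (T? ∘ primitive?)
      (∈-filter⁺ (T? ∘ isRep) (∈-compositions⁺ _ μ-composition) (proj₂ (proj₂ (isRep-rotateN x xs))))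
      (Primitive⇒primitive? (Primitive-rotateN r₀ v-primitive))
    inverse : ∃ λ r → r < length v × rotateN r μ ≡ v
    inverse = rotateN-inverse r₀
    r : ℕ
    r = proj₁ inverse
    r<length : r < length μ
    r<length = subst (r <_) (sym (length-rotateN r₀ v)) (proj₁ (proj₂ inverse))
    μ-back : rotateN r μ ≡ v
    μ-back = proj₂ (proj₂ inverse)

  compositions⊆factored : 0 < n → ∀ {w} → w ∈ compositions n → w ∈ factored
  compositions⊆factored 0<n {w} w∈ with primitive-root w
  ... | d , v , v-primitive , refl = power-∈-factored 0<n d v-primitive (∈-compositions⁻ n w∈)

  power-rotateN-injective : ∀ {i i′ μ μ′ r r′} → i ∈ divisors → i′ ∈ divisors →
    μ ∈ primitiveClasses i → μ′ ∈ primitiveClasses i′ → r < length μ → r′ < length μ′ →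
    power (suc i) (rotateN r μ) ≡ power (suc i′) (rotateN r′ μ′) → i ≡ i′ × μ ≡ μ′
  power-rotateN-injective {i} {i′} {μ} {μ′} {r} {r′} i∈ i′∈ μ∈ μ′∈ r< r′< e = i≡i′ , μ≡μ′
    where
    open PrimitiveClass (∈-primitiveClasses⁻ i∈ μ∈)
    open PrimitiveClass (∈-primitiveClasses⁻ i′∈ μ′∈) using () renaming
      (representative to representative′; isPrimitive to isPrimitive′; nonempty to nonempty′)
    roots : i ≡ i′ × rotateN r μ ≡ rotateN r′ μ′
    roots = primitive-root-unique i i′ (Primitive-rotateN r isPrimitive) (Primitive-rotateN r′ isPrimitive′)
              (subst (0 <_) (sym (length-rotateN r μ)) nonempty) (subst (0 <_) (sym (length-rotateN r′ μ′)) nonempty′) e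
    i≡i′ : i ≡ i′
    i≡i′ = proj₁ roots
    μ′-rotation : μ′ ≡ rotateN (r + (length μ′ ∸ r′)) μ
    μ′-rotation = begin
      μ′                                          ≡⟨ rotateN-∸-inverse μ′ (<⇒≤ r′<) ⟨
      rotateN (length μ′ ∸ r′) (rotateN r′ μ′)    ≡⟨ cong (rotateN (length μ′ ∸ r′)) (proj₂ roots) ⟨
      rotateN (length μ′ ∸ r′) (rotateN r μ)      ≡⟨ rotateN-+ r (length μ′ ∸ r′) μ ⟨
      rotateN (r + (length μ′ ∸ r′)) μ            ∎
    μ≡μ′ : μ ≡ μ′
    μ≡μ′ = isRep-unique (r + (length μ′ ∸ r′)) nonempty representative representative′ μ′-rotation

  powersOfRotations-Unique : ∀ {i μ} → i ∈ divisors → μ ∈ primitiveClasses i → Unique (powersOfRotations i μ)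
  powersOfRotations-Unique {i} {μ} i∈ μ∈ = map⁺-local _ (upTo⁺ (length μ)) injective
    where
    μ-primitive : Primitive μ
    μ-primitive = PrimitiveClass.isPrimitive (∈-primitiveClasses⁻ i∈ μ∈)
    injective : ∀ {r r′} → r ∈ upTo (length μ) → r′ ∈ upTo (length μ) →
                power (suc i) (rotateN r μ) ≡ power (suc i) (rotateN r′ μ) → r ≡ r′
    injective {r} {r′} r∈ r′∈ e with power-injective i (trans (length-rotateN r μ) (sym (length-rotateN r′ μ))) e | <-cmp r r′
    ... | e′ | tri< r<r′ _ _ = contradiction e′ (rotateN-injective μ-primitive r<r′ (∈-upTo⁻ r′∈))
    ... | _  | tri≈ _ r≡r′ _ = r≡r′
    ... | e′ | tri> _ _ r′<r = contradiction (sym e′) (rotateN-injective μ-primitive r′<r (∈-upTo⁻ r∈))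

  powersOfClasses-Unique : ∀ {i} → i ∈ divisors → Unique (powersOfClasses i)
  powersOfClasses-Unique {i} i∈ = concatMap⁺ (powersOfRotations i)
    (filter⁺ (T? ∘ primitive?) (filter⁺ (T? ∘ isRep) (compositions-Unique (n / suc i))))
    (powersOfRotations-Unique i∈) disjoint
    where
    disjoint : ∀ {μ μ′ w} → μ ∈ primitiveClasses i → μ′ ∈ primitiveClasses i →
               w ∈ powersOfRotations i μ → w ∈ powersOfRotations i μ′ → μ ≡ μ′
    disjoint {μ} {μ′} μ∈ μ′∈ w∈ w∈′ with ∈-powersOfRotations⁻ {i} {μ} w∈ | ∈-powersOfRotations⁻ {i} {μ′} w∈′
    ... | r , r< , refl | r′ , r′< , e = proj₂ (power-rotateN-injective i∈ i∈ μ∈ μ′∈ r< r′< e)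

  factored-Unique : Unique factored
  factored-Unique = concatMap⁺ powersOfClasses (filter⁺ (λ i → suc i ∣? n) (upTo⁺ n)) powersOfClasses-Unique disjoint
    where
    disjoint : ∀ {i i′ w} → i ∈ divisors → i′ ∈ divisors → w ∈ powersOfClasses i → w ∈ powersOfClasses i′ → i ≡ i′
    disjoint {i} {i′} i∈ i′∈ w∈ w∈′ with ∈-powersOfClasses⁻ {i} w∈ | ∈-powersOfClasses⁻ {i′} w∈′
    ... | μ , r , μ∈ , r< , refl | μ′ , r′ , μ′∈ , r′< , e = proj₁ (power-rotateN-injective i∈ i′∈ μ∈ μ′∈ r< r′< e)

  sumℚ-powersOfRotations : ∀ {i μ} → i ∈ divisors → μ ∈ primitiveClasses i →
    sumℚ (map (weight n ∘ length) (powersOfRotations i μ)) ≡ (n C (ord μ * suc i ∸ 1)) /1+ i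
  sumℚ-powersOfRotations {i} {μ} i∈ μ∈ = begin
    sumℚ (map (weight n ∘ length) (map (λ r → power (suc i) (rotateN r μ)) (upTo L)))
      ≡⟨ cong sumℚ (map-∘ {g = weight n ∘ length} {f = λ r → power (suc i) (rotateN r μ)} (upTo L)) ⟨
    sumℚ (map (λ r → weight n (length (power (suc i) (rotateN r μ)))) (upTo L))
      ≡⟨ cong sumℚ (map-cong-local {xs = upTo L} (All.tabulate λ {r} _ → cong (weight n) (length-powerRotation r))) ⟩
    sumℚ (map (λ _ → (n C K) /1+ K) (upTo L))
      ≡⟨ sumℚ-const (n C K) K (upTo L) ⟩
    (length (upTo L) * (n C K)) /1+ K
      ≡⟨ cong (λ l → (l * (n C K)) /1+ K) (length-upTo L) ⟩
    (L * (n C K)) /1+ K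
      ≡⟨ /1+-≡ (L * (n C K)) K (n C (ord μ * suc i ∸ 1)) i cross ⟩
    (n C (ord μ * suc i ∸ 1)) /1+ i ∎
    where
    open PrimitiveClass (∈-primitiveClasses⁻ i∈ μ∈)
    L K : ℕ
    L = length μ
    K = suc i * L ∸ 1
    length-powerRotation : ∀ r → length (power (suc i) (rotateN r μ)) ≡ suc i * L
    length-powerRotation r = trans (length-power (suc i) (rotateN r μ)) (cong (suc i *_) (length-rotateN r μ))
    ord≡L : ord μ ≡ L
    ord≡L = toWitness (Primitive⇒primitive? isPrimitive)
    1+K≡ : suc K ≡ suc i * L
    1+K≡ = suc-pred (suc i * L) {{m*n≢0 (suc i) L {{_}} {{>-nonZero nonempty}}}}
    cross : (L * (n C K)) * suc i ≡ (n C (ord μ * suc i ∸ 1)) * suc K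
    cross = begin
      (L * (n C K)) * suc i              ≡⟨ rearrange L (n C K) (suc i) ⟩
      (n C K) * (suc i * L)              ≡⟨ cong₂ (λ k l → (n C (k ∸ 1)) * l) (trans (*-comm (suc i) L) (cong (_* suc i) (sym ord≡L))) (sym 1+K≡) ⟩
      (n C (ord μ * suc i ∸ 1)) * suc K  ∎
      where
      rearrange : ∀ a b s → (a * b) * s ≡ b * (s * a)
      rearrange = solve-∀

  sumℚ-factored : sumℚ (map (weight n ∘ length) factored) ≡ rhs n
  sumℚ-factored = begin
    sumℚ (map (weight n ∘ length) (concatMap powersOfClasses divisors))
      ≡⟨ sumℚ-concatMap (weight n ∘ length) powersOfClasses divisors ⟩
    sumℚ (map (λ i → sumℚ (map (weight n ∘ length) (powersOfClasses i))) divisors)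
      ≡⟨ cong sumℚ (map-cong-local (All.tabulate λ {i} i∈ → trans
           (sumℚ-concatMap (weight n ∘ length) (powersOfRotations i) (primitiveClasses i))
           (cong sumℚ (map-cong-local (All.tabulate (sumℚ-powersOfRotations i∈)))))) ⟩
    rhs n ∎

corollary5p6 : (n : ℕ) → n ≥ 1 → catalan n ≡ rhs n
corollary5p6 n@(suc m) 0<n = begin
  catalan n                                          ≡⟨ catalan≡sum-compositions m ⟩
  sumℚ (map (weight n ∘ length) (compositions n))    ≡⟨ sumℚ-Unique (weight n ∘ length) (compositions-Unique n) factored-Unique
                                                                    (compositions⊆factored 0<n) factored⊆compositions ⟩
  sumℚ (map (weight n ∘ length) factored)            ≡⟨ sumℚ-factored ⟩
  rhs n                                              ∎
  where open Factorisation n
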